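{- Let $p$ be a prime, $m,n,k$ positive integers, and let $A\in M(m,n,\mathbb{F}_p)$ have rank at least $k$. Let $k'$ be an integer with $1\le k'\le k/2$ and let $0<\delta<1$ satisfy $\log(1/\delta)\ge k$. Let $Q\in M\left(\left\lceil \frac{8k'\log(1/\delta)}{k}\right\rceil, m,\mathbb{F}_p\right)$ have entries sampled independently and uniformly from $\{0,1,\dots,p-1\}$. Then with probability at least $1-\delta$, the matrix $QA$ has rank at least $k'$.
   Context: $M(a,b,\mathbb{F}_p)$ denotes the space of $a\times b$ matrices over $\mathbb{F}_p$. Logarithms are base 2.
   Formalization: The parameter δ takes only rational values. -}

module Defs where

open import Data.Nat using (ℕ; zero; suc; _+_; _*_; NonZero)
open import Data.Nat.DivMod using (_mod_)
open import Data.Fin using (Fin; toℕ) renaming (zero to fz; suc to fs)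
open import Data.Bool using (Bool; true; false; _∧_; _∨_; not)
open import Data.List using (List; []; _∷_; map; concatMap; filter; length; allFin)
open import Data.Bool.ListAction using (all; any)
open import Relation.Nullary.Decidable using (does)
open import Data.Nat using (_≟_)

-- Matrices over F_p: an a × b matrix is a function Fin a → Fin b → Fin p,
-- F_p being represented by Fin p = {0,…,p-1} with arithmetic mod p.
Mat : ℕ → ℕ → ℕ → Set
Mat p a b = Fin a → Fin b → Fin p

sumFin : (n : ℕ) → (Fin n → ℕ) → ℕ
sumFin zero    f = 0
sumFin (suc n) f = f fz + sumFin n (λ i → f (fs i))

_⊗[_]_ : ∀ {a b c} → (p : ℕ) → .{{_ : NonZero p}} → Mat p a b → Mat p b c → Mat p a c
_⊗[_]_ {b = b} p Q A i j = sumFin b (λ l → toℕ (Q i l) * toℕ (A l j)) mod p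

allFuns : {X : Set} → List X → (n : ℕ) → List (Fin n → X)
allFuns xs zero    = (λ ()) ∷ []
allFuns xs (suc n) =
  concatMap (λ x → map (λ f → λ { fz → x ; (fs i) → f i }) (allFuns xs n)) xs

isZero : ∀ {p} → Fin p → Bool
isZero x = does (toℕ x ≟ 0)

rowsIndependent : ∀ {a b} (p : ℕ) → .{{_ : NonZero p}} → Mat p a b → (k : ℕ) → (Fin k → Fin a) → Bool
rowsIndependent {b = b} p A k σ =
  all (λ c → not (all (λ j → isZero (sumFin k (λ i → toℕ (c i) * toℕ (A (σ i) j)) mod p)) (allFin b))
             ∨ all isZero (map c (allFin k)))
      (allFuns (allFin p) k)

rankAtLeast : ∀ {a b} (p : ℕ) → .{{_ : NonZero p}} → Mat p a b → ℕ → Bool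
rankAtLeast {a = a} p A k = any (rowsIndependent p A k) (allFuns (allFin a) k)

allMats : (p r m : ℕ) → List (Mat p r m)
allMats p r m = allFuns (allFuns (allFin p) m) r

goodCount : ∀ {m n} (p : ℕ) → .{{_ : NonZero p}} → (r : ℕ) → Mat p m n → ℕ → ℕ
goodCount {m} p r A k' = length (filter (λ Q → rankAtLeast p (p ⊗[ Q ] A) k' Data.Bool.≟ true) (allMats p r m))

-- Reveal the rows of Q one at a time and keep a row when its image under A is independent of the
-- images of the rows kept before; as soon as k' rows are kept they witness rank (QA) ≥ k'. While the
-- list S of kept rows is shorter than k', at most a p^(|S|+1-k) ≤ p^-(k-k') fraction of all rows is
-- rejected: a rejected row x together with any y ∈ F_p^k is determined by a relation c expressing the
-- dependence of x on S and by the vector c₀ x + Σ cᵢ Sᵢ + Σ yᵢ e_{τ i}, where τ are k independent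
-- rows of A. By induction on the number of revealed rows, the matrices with fewer than k' kept rows
-- form at most a patternBound r k' · p^-((k-k')(r+1-k')) fraction of all r × m matrices, and
-- comparing 8k'-th powers with the defining inequality of r shows that this is at most a/b = δ.

module Submission where

open import Defs
open import Level using (0ℓ)
open import Data.Nat
  using (ℕ; zero; suc; _+_; _*_; _^_; _∸_; _≤_; _<_; z≤n; s≤s; s≤s⁻¹; NonZero; >-nonZero; pred; _≟_; _≤?_; _<?_)
open import Data.Nat.Base using (nonTrivial⇒n>1)
open import Data.Nat.Properties
  using (module ≤-Reasoning; *-assoc; *-cancelʳ-≤; *-cancelˡ-≤; *-comm; *-distribʳ-+; *-distribʳ-∸
    ; *-distribˡ-+; *-distribˡ-∸; *-identityʳ; *-identityˡ; *-mono-≤; *-monoʳ-≤; *-monoˡ-≤; *-suc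
    ; *-zeroʳ; +-assoc; +-comm; +-identityʳ; +-mono-≤; +-monoʳ-≤; +-suc; 0∸n≡0; <⇒≱; ^-*-assoc
    ; ^-distribˡ-+-*; ^-monoʳ-<; ^-monoʳ-≤; ^-monoˡ-<; ^-monoˡ-≤; m+[n∸m]≡n; m+n∸n≡m; m+n≤o⇒m≤o∸n
    ; m^n>0; m^n≢0; m∸n+n≡m; m≤m+n; m≤n*m; m≤n+m; m≤n+o⇒m∸n≤o; m≤n⇒m≤1+n; n≤1+n; suc-pred; ∸-monoʳ-≤
    ; ∸-monoˡ-≤; ≡ᵇ⇒≡; ≡⇒≡ᵇ; ≤-refl; ≤-reflexive; ≤-total; ≤-trans; ≰⇒>)
open import Data.Nat.DivMod
  using (_%_; _mod_; m%n%n≡m%n; [m+kn]%n≡m%n; %-distribˡ-+; %-distribˡ-*; m<n⇒m%n≡m; m*n%n≡0)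
open import Data.Nat.Divisibility using (_∣_; m%n≡0⇒n∣m; n∣m⇒m%n≡0)
open import Data.Nat.Primality using (Prime; euclidsLemma; prime⇒nonZero; prime⇒nonTrivial)
open import Data.Nat.ListAction using (sum)
open import Data.Nat.Tactic.RingSolver using (solve-∀)
open import Data.Bool using (Bool; true; false; T; not; _∨_; if_then_else_)
import Data.Bool as Bool
open import Data.Bool.Properties using (T-≡)
open import Data.Bool.ListAction using (all)
open import Data.Fin using (Fin; toℕ) renaming (zero to fz; suc to fs)
open import Data.Fin.Properties using (toℕ<n; toℕ-injective; toℕ-fromℕ<)
import Data.Fin.Properties as Fin
open import Data.List
  using (List; []; _∷_; _++_; [_]; map; concatMap; filter; length; lookup; allFin; cartesianProduct)
open import Data.List.Properties
  using ( length-++; length-map; length-tabulate; length-removeAt′; length-filter; filter-++; filter-≐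
        ; filter-none; map-cong; ++-assoc; ++-identityʳ)
open import Data.List.Membership.Propositional using (_∈_; lose)
open import Data.List.Membership.Propositional.Properties
  using (∈-map⁺; ∈-concatMap⁺; ∈-allFin; ∈-lookup; ∈-filter⁻; ∈-cartesianProduct⁺; ∈-cartesianProduct⁻)
open import Data.List.Relation.Unary.Any as Any using (Any; here; there; _─_)
import Data.List.Relation.Unary.Any.Properties as Any
open import Data.List.Relation.Unary.All as All using (All; []; _∷_)
import Data.List.Relation.Unary.All.Properties as All
import Data.List.Relation.Unary.AllPairs as AllPairs
import Data.List.Relation.Unary.AllPairs.Properties as AllPairs
open import Data.List.Relation.Unary.Unique.Setoid using (Unique)
import Data.List.Relation.Unary.Unique.Setoid.Properties as Unique
open import Data.List.Relation.Unary.Unique.Propositional.Properties using (allFin⁺)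
open import Data.Product using (∃; ∃-syntax; _×_; _,_; proj₁; proj₂)
open import Data.Product.Relation.Binary.Pointwise.NonDependent using (×-setoid)
open import Data.Sum using (_⊎_; inj₁; inj₂; [_,_]′)
open import Function using (_∘_; Equivalence)
open import Relation.Nullary using (¬_; Dec; yes; no; does; contradiction)
open import Relation.Nullary.Decidable using (¬?; _×-dec_; dec-true; dec-false)
open import Relation.Unary using (Pred; Decidable)
open import Relation.Binary.Bundles using (Setoid)
import Relation.Binary.Reasoning.Setoid
open import Relation.Binary.PropositionalEquality
  using ( _≡_; _≢_; _≗_; refl; sym; trans; cong; cong₂; subst; subst₂; _→-setoid_; setoid
        ; module ≡-Reasoning)

private variable
  X Y : Set

allFuns-complete : (xs : List X) {n : ℕ} (f : Fin n → X) → (∀ i → f i ∈ xs) →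
                   ∃[ g ] g ∈ allFuns xs n × g ≗ f
allFuns-complete xs {zero}  f f∈xs = _ , here refl , λ ()
allFuns-complete xs {suc n} f f∈xs
  with g , g∈ , g≗f ← allFuns-complete xs (f ∘ fs) (f∈xs ∘ fs)
  = _ , ∈-concatMap⁺ _ (Any.map (λ { refl → ∈-map⁺ _ g∈ }) (f∈xs fz))
      , λ { fz → refl ; (fs i) → g≗f i }

length-concatMap : (F : X → List Y) {c : ℕ} → (∀ x → length (F x) ≡ c) →
                   ∀ xs → length (concatMap F xs) ≡ length xs * c
length-concatMap F |F|≡c []       = refl
length-concatMap F |F|≡c (x ∷ xs) =
  trans (length-++ (F x)) (cong₂ _+_ (|F|≡c x) (length-concatMap F |F|≡c xs))

length-allFuns : (xs : List X) (n : ℕ) → length (allFuns xs n) ≡ length xs ^ n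
length-allFuns xs zero    = refl
length-allFuns xs (suc n) =
  length-concatMap _ (λ _ → trans (length-map _ (allFuns xs n)) (length-allFuns xs n)) xs

allFuns-unique : {xs : List X} → Unique (setoid X) xs →
                 ∀ n → Unique (Fin n →-setoid X) (allFuns xs n)
allFuns-unique xs-unique zero    = [] AllPairs.∷ AllPairs.[]
allFuns-unique {X = X} {xs} xs-unique (suc n) =
  Unique.concat⁺ (Fin (suc n) →-setoid X)
    (All.map⁺ (All.universal (λ _ → Unique.map⁺ (Fin n →-setoid X) (Fin (suc n) →-setoid X)
                                        (λ eq i → eq (fs i)) (allFuns-unique xs-unique n)) xs))
    (AllPairs.map⁺ (AllPairs.map disjoint xs-unique))
  where
  -- The `_` is the anonymous function prepending a head, as in the definition of allFuns.
  head≡ : ∀ {x v} → Any (v ≗_) (map _ (allFuns xs n)) → v fz ≡ x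
  head≡ v∈ with _ , v≗ ← Any.satisfied (Any.map⁻ v∈) = v≗ fz
  disjoint : ∀ {x y} → x ≢ y → ∀ {v} → ¬ (_ × _)
  disjoint x≢y (v∈x , v∈y) = x≢y (trans (sym (head≡ v∈x)) (head≡ v∈y))

∃-allFuns? : (xs : List X) → (∀ x → x ∈ xs) → ∀ {n} {P : (Fin n → X) → Set} →
             (∀ {f g} → f ≗ g → P f → P g) → Decidable P → Dec (∃ P)
∃-allFuns? xs every∈ {n} P-resp P? with Any.any? P? (allFuns xs n)
... | yes found = yes (Any.satisfied found)
... | no ¬found = no λ (f , Pf) →
  let g , g∈ , g≗f = allFuns-complete xs f (every∈ ∘ f)
  in  ¬found (lose g∈ (P-resp (sym ∘ g≗f) Pf))

∈-─ : ∀ {y y' : Y} {ys} (y∈ : y ∈ ys) → y' ∈ ys → y ≡ y' ⊎ y' ∈ (ys ─ y∈)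
∈-─ (here refl) (here refl)  = inj₁ refl
∈-─ (here refl) (there y'∈)  = inj₂ y'∈
∈-─ (there y∈)  (here refl)  = inj₂ (here refl)
∈-─ (there y∈)  (there y'∈) with ∈-─ y∈ y'∈
... | inj₁ y≡y' = inj₁ y≡y'
... | inj₂ y'∈' = inj₂ (there y'∈')

module _ (S : Setoid 0ℓ 0ℓ) where
  open Setoid S using (Carrier; _≈_)

  length-≤-by-coding : (R : Carrier → Y → Set) → (∀ {x x' y} → R x y → R x' y → x ≈ x') →
                       ∀ {xs} ys → Unique S xs → (∀ {x} → x ∈ xs → ∃[ y ] y ∈ ys × R x y) →
                       length xs ≤ length ys
  length-≤-by-coding R decode {[]}     ys _                        code = z≤n
  length-≤-by-coding R decode {x ∷ xs} ys (x≉xs AllPairs.∷ unique) code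
    with y , y∈ , Rxy ← code (here refl) = ≤-trans
      (s≤s (length-≤-by-coding R decode (ys ─ y∈) unique code′))
      (≤-reflexive (sym (length-removeAt′ ys (Any.index y∈))))
    where
    code′ : ∀ {x′} → x′ ∈ xs → ∃[ y ] y ∈ (ys ─ y∈) × R x′ y
    code′ x′∈ with y′ , y′∈ , Rx′y′ ← code (there x′∈) | ∈-─ y∈ y′∈
    ... | inj₁ refl = contradiction (decode Rxy Rx′y′) (All.lookup x≉xs x′∈)
    ... | inj₂ y′∈′ = y′ , y′∈′ , Rx′y′

module _ {P : Pred X 0ℓ} (P? : Decidable P) where

  length-filter-concatMap : (F : Y → List X) → ∀ ys →
    length (filter P? (concatMap F ys)) ≡ sum (map (λ y → length (filter P? (F y))) ys)
  length-filter-concatMap F []       = refl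
  length-filter-concatMap F (y ∷ ys) = trans
    (cong length (filter-++ P? (F y) (concatMap F ys)))
    (trans (length-++ (filter P? (F y))) (cong (_ +_) (length-filter-concatMap F ys)))

  length-filter-map : (f : Y → X) → ∀ ys →
                      length (filter P? (map f ys)) ≡ length (filter (P? ∘ f) ys)
  length-filter-map f []       = refl
  length-filter-map f (y ∷ ys) with does (P? (f y))
  ... | true  = cong suc (length-filter-map f ys)
  ... | false = length-filter-map f ys

  length-filter+length-filter-¬ : ∀ xs →
    length (filter P? xs) + length (filter (¬? ∘ P?) xs) ≡ length xs
  length-filter+length-filter-¬ []       = refl
  length-filter+length-filter-¬ (x ∷ xs) with does (P? x)
  ... | true  = cong suc (length-filter+length-filter-¬ xs)
  ... | false = trans (+-suc _ _) (cong suc (length-filter+length-filter-¬ xs))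

  sum-*-≤ : (f : X → ℕ) {w a b : ℕ} →
            (∀ {x} → P x → f x * w ≤ b) → (∀ {x} → ¬ P x → f x * w ≤ a) →
            ∀ xs → sum (map f xs) * w ≤ length xs * a + length (filter P? xs) * b
  sum-*-≤ f P⇒≤b ¬P⇒≤a []       = z≤n
  sum-*-≤ f {w} {a} {b} P⇒≤b ¬P⇒≤a (x ∷ xs) with P? x
  ... | yes Px = begin
    (f x + sum (map f xs)) * w    ≡⟨ *-distribʳ-+ w (f x) _ ⟩
    f x * w + sum (map f xs) * w  ≤⟨ +-mono-≤ (P⇒≤b Px) (sum-*-≤ f P⇒≤b ¬P⇒≤a xs) ⟩
    b + (n * a + #P * b)          ≤⟨ m≤n+m _ a ⟩
    a + (b + (n * a + #P * b))    ≡⟨ rearrange a b (n * a) (#P * b) ⟩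
    a + n * a + (b + #P * b)      ∎
    where
    open ≤-Reasoning
    n #P : ℕ
    n = length xs
    #P = length (filter P? xs)
    rearrange : ∀ a b c d → a + (b + (c + d)) ≡ a + c + (b + d)
    rearrange = solve-∀
  ... | no ¬Px = begin
    (f x + sum (map f xs)) * w    ≡⟨ *-distribʳ-+ w (f x) _ ⟩
    f x * w + sum (map f xs) * w  ≤⟨ +-mono-≤ (¬P⇒≤a ¬Px) (sum-*-≤ f P⇒≤b ¬P⇒≤a xs) ⟩
    a + (n * a + #P * b)          ≡⟨ +-assoc a _ _ ⟨
    a + n * a + #P * b            ∎
    where
    open ≤-Reasoning
    n #P : ℕ
    n = length xs
    #P = length (filter P? xs)

length-filter-mono : {P Q : Pred X 0ℓ} (P? : Decidable P) (Q? : Decidable Q) →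
                     (∀ {x} → P x → Q x) →
                     ∀ xs → length (filter P? xs) ≤ length (filter Q? xs)
length-filter-mono P? Q? P⇒Q []       = z≤n
length-filter-mono P? Q? P⇒Q (x ∷ xs) with P? x | Q? x
... | yes _  | yes _  = s≤s (length-filter-mono P? Q? P⇒Q xs)
... | yes Px | no ¬Qx = contradiction (P⇒Q Px) ¬Qx
... | no _   | yes _  = m≤n⇒m≤1+n (length-filter-mono P? Q? P⇒Q xs)
... | no _   | no _   = length-filter-mono P? Q? P⇒Q xs

length-cartesianProduct : (xs : List X) (ys : List Y) →
                          length (cartesianProduct xs ys) ≡ length xs * length ys
length-cartesianProduct []       ys = refl
length-cartesianProduct (x ∷ xs) ys =
  trans (length-++ (map (x ,_) ys)) (cong₂ _+_ (length-map (x ,_) ys) (length-cartesianProduct xs ys))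

sumFin-cong : ∀ n {f g : Fin n → ℕ} → f ≗ g → sumFin n f ≡ sumFin n g
sumFin-cong zero    f≗g = refl
sumFin-cong (suc n) f≗g = cong₂ _+_ (f≗g fz) (sumFin-cong n (f≗g ∘ fs))

sumFin-+ : ∀ n (f g : Fin n → ℕ) → sumFin n (λ i → f i + g i) ≡ sumFin n f + sumFin n g
sumFin-+ zero    f g = refl
sumFin-+ (suc n) f g = trans (cong (f fz + g fz +_) (sumFin-+ n (f ∘ fs) (g ∘ fs)))
                             (interchange (f fz) (g fz) _ _)
  where
  interchange : ∀ a b c d → a + b + (c + d) ≡ a + c + (b + d)
  interchange = solve-∀

*-distribˡ-sumFin : ∀ n c (f : Fin n → ℕ) → c * sumFin n f ≡ sumFin n (λ i → c * f i)
*-distribˡ-sumFin zero    c f = *-zeroʳ c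
*-distribˡ-sumFin (suc n) c f =
  trans (*-distribˡ-+ c (f fz) _) (cong (c * f fz +_) (*-distribˡ-sumFin n c (f ∘ fs)))

sumFin-zero : ∀ n → sumFin n (λ _ → 0) ≡ 0
sumFin-zero zero    = refl
sumFin-zero (suc n) = sumFin-zero n

sumFin-swap : ∀ a b (f : Fin a → Fin b → ℕ) →
              sumFin a (λ i → sumFin b (f i)) ≡ sumFin b (λ l → sumFin a (λ i → f i l))
sumFin-swap zero    b f = sym (sumFin-zero b)
sumFin-swap (suc a) b f = trans (cong (sumFin b (f fz) +_) (sumFin-swap a b (f ∘ fs)))
                                (sym (sumFin-+ b (f fz) _))

*-distribʳ-sumFin : ∀ n c (f : Fin n → ℕ) → sumFin n f * c ≡ sumFin n (λ i → f i * c)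
*-distribʳ-sumFin n c f =
  trans (*-comm (sumFin n f) c) (trans (*-distribˡ-sumFin n c f) (sumFin-cong n (λ i → *-comm c (f i))))

infixl 7 _·_
_·_ : ∀ {N d} → (Fin N → ℕ) → (Fin N → Fin d → ℕ) → Fin d → ℕ
(_·_ {N} u v) j = sumFin N (λ i → u i * v i j)

·-assoc : ∀ {N m d} (u : Fin N → ℕ) (v : Fin N → Fin m → ℕ) (w : Fin m → Fin d → ℕ) →
          (u · v) · w ≗ u · (λ i → v i · w)
·-assoc {N} {m} u v w j = let open ≡-Reasoning in begin
  sumFin m (λ l → sumFin N (λ i → u i * v i l) * w l j)
    ≡⟨ sumFin-cong m (λ l → *-distribʳ-sumFin N (w l j) _) ⟩
  sumFin m (λ l → sumFin N (λ i → u i * v i l * w l j))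
    ≡⟨ sumFin-swap N m _ ⟨
  sumFin N (λ i → sumFin m (λ l → u i * v i l * w l j))
    ≡⟨ sumFin-cong N (λ i → trans (sumFin-cong m (λ l → *-assoc (u i) (v i l) (w l j)))
                                  (sym (*-distribˡ-sumFin m (u i) _))) ⟩
  sumFin N (λ i → u i * sumFin m (λ l → v i l * w l j)) ∎

·-distribʳ-+ : ∀ {N d} (u u' : Fin N → ℕ) (v : Fin N → Fin d → ℕ) →
               (λ i → u i + u' i) · v ≗ λ j → (u · v) j + (u' · v) j
·-distribʳ-+ {N} u u' v j =
  trans (sumFin-cong N (λ i → *-distribʳ-+ (v i j) (u i) (u' i))) (sumFin-+ N _ _)

unit : ∀ {m} → Fin m → Fin m → ℕ
unit fz     fz     = 1
unit fz     (fs _) = 0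
unit (fs _) fz     = 0
unit (fs a) (fs b) = unit a b

sumFin-unit : ∀ m (a : Fin m) (f : Fin m → ℕ) → sumFin m (λ l → unit a l * f l) ≡ f a
sumFin-unit (suc m) fz     f = trans (cong₂ _+_ (*-identityˡ (f fz)) (sumFin-zero m)) (+-identityʳ (f fz))
sumFin-unit (suc m) (fs a) f = sumFin-unit m a (f ∘ fs)

module Congruence (p : ℕ) .{{_ : NonZero p}} where

  infix 4 _≈_
  _≈_ : ℕ → ℕ → Set
  x ≈ y = x % p ≡ y % p

  ≈-setoid : Setoid _ _
  ≈-setoid = record
    { _≈_ = _≈_
    ; isEquivalence = record { refl = refl ; sym = sym ; trans = trans }
    }

  module ≈-Reasoning = Relation.Binary.Reasoning.Setoid ≈-setoid

  0%p≡0 : 0 % p ≡ 0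
  0%p≡0 = m*n%n≡0 0 p

  +-cong : ∀ {a a' b b'} → a ≈ a' → b ≈ b' → a + b ≈ a' + b'
  +-cong {a} {a'} {b} {b'} a≈a' b≈b' = let open ≡-Reasoning in begin
    (a + b) % p                 ≡⟨ %-distribˡ-+ a b p ⟩
    (a % p + b % p) % p         ≡⟨ cong₂ (λ u v → (u + v) % p) a≈a' b≈b' ⟩
    (a' % p + b' % p) % p       ≡⟨ %-distribˡ-+ a' b' p ⟨
    (a' + b') % p               ∎

  *-cong : ∀ {a a' b b'} → a ≈ a' → b ≈ b' → a * b ≈ a' * b'
  *-cong {a} {a'} {b} {b'} a≈a' b≈b' = let open ≡-Reasoning in begin
    (a * b) % p                 ≡⟨ %-distribˡ-* a b p ⟩
    (a % p * (b % p)) % p       ≡⟨ cong₂ (λ u v → (u * v) % p) a≈a' b≈b' ⟩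
    (a' % p * (b' % p)) % p     ≡⟨ %-distribˡ-* a' b' p ⟨
    (a' * b') % p               ∎

  sumFin-≈ : ∀ n {f g : Fin n → ℕ} → (∀ i → f i ≈ g i) → sumFin n f ≈ sumFin n g
  sumFin-≈ zero    f≈g = refl
  sumFin-≈ (suc n) f≈g = +-cong (f≈g fz) (sumFin-≈ n (f≈g ∘ fs))

  %-≈ : ∀ x → x % p ≈ x
  %-≈ x = m%n%n≡m%n x p

  toℕ-mod-≈ : ∀ x → toℕ (x mod p) ≈ x
  toℕ-mod-≈ x = trans (cong (_% p) (toℕ-fromℕ< _)) (%-≈ x)

  *p≈0 : ∀ x → x * p ≈ 0
  *p≈0 x = trans (m*n%n≡0 x p) (sym 0%p≡0)

  -- Subtraction is avoided by adding c * pred p, which represents -c.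
  +-cancelʳ : ∀ {a b} c → a + c ≈ b + c → a ≈ b
  +-cancelʳ {a} {b} c a+c≈b+c = begin
    a                       ≈⟨ [m+kn]%n≡m%n a c p ⟨
    a + c * p               ≡⟨ cong (a +_) c*p ⟩
    a + (c + c * pred p)    ≡⟨ +-assoc a c _ ⟨
    a + c + c * pred p      ≈⟨ +-cong a+c≈b+c refl ⟩
    b + c + c * pred p      ≡⟨ +-assoc b c _ ⟩
    b + (c + c * pred p)    ≡⟨ cong (b +_) c*p ⟨
    b + c * p               ≈⟨ [m+kn]%n≡m%n b c p ⟩
    b                       ∎
    where
    open ≈-Reasoning
    c*p : c * p ≡ c + c * pred p
    c*p = trans (cong (c *_) (sym (suc-pred p))) (*-suc c (pred p))

  +-cancelˡ : ∀ {a b} c → c + a ≈ c + b → a ≈ b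
  +-cancelˡ {a} {b} c c+a≈c+b =
    +-cancelʳ c (trans (cong (_% p) (+-comm a c)) (trans c+a≈c+b (cong (_% p) (+-comm c b))))

  +-negate : ∀ x → x + pred p * x ≈ 0
  +-negate x = trans (cong (_% p) (trans (cong (_* x) (suc-pred p)) (*-comm p x))) (*p≈0 x)

  toℕ-≈-injective : {x y : Fin p} → toℕ x ≈ toℕ y → x ≡ y
  toℕ-≈-injective {x} {y} x≈y =
    toℕ-injective (trans (sym (m<n⇒m%n≡m (toℕ<n x))) (trans x≈y (m<n⇒m%n≡m (toℕ<n y))))

  toℕ-≈0 : (x : Fin p) → toℕ x ≈ 0 → toℕ x ≡ 0
  toℕ-≈0 x x≈0 = trans (sym (m<n⇒m%n≡m (toℕ<n x))) (trans x≈0 0%p≡0)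

  ≈0⇒∣ : ∀ {x} → x ≈ 0 → p ∣ x
  ≈0⇒∣ {x} x≈0 = m%n≡0⇒n∣m x p (trans x≈0 0%p≡0)

  ∣⇒≈0 : ∀ {x} → p ∣ x → x ≈ 0
  ∣⇒≈0 {x} p∣x = trans (n∣m⇒m%n≡0 x p p∣x) (sym 0%p≡0)

  module _ (prime-p : Prime p) where

    private
      *-cancelˡ-ordered : ∀ {c x y} → ¬ c ≈ 0 → x ≤ y → c * x ≈ c * y → x ≈ y
      *-cancelˡ-ordered {c} {x} {y} c≉0 x≤y cx≈cy =
        [ (λ p∣c → contradiction (∣⇒≈0 p∣c) c≉0) , d≈0⇒x≈y ∘ ∣⇒≈0 ]′
          (euclidsLemma c (y ∸ x) prime-p (≈0⇒∣ cd≈0))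
        where
        open ≈-Reasoning
        cd≈0 : c * (y ∸ x) ≈ 0
        cd≈0 = +-cancelˡ (c * x) (begin
          c * x + c * (y ∸ x)   ≡⟨ *-distribˡ-+ c x (y ∸ x) ⟨
          c * (x + (y ∸ x))     ≡⟨ cong (c *_) (m+[n∸m]≡n x≤y) ⟩
          c * y                 ≈⟨ cx≈cy ⟨
          c * x                 ≡⟨ +-identityʳ (c * x) ⟨
          c * x + 0             ∎)
        d≈0⇒x≈y : y ∸ x ≈ 0 → x ≈ y
        d≈0⇒x≈y d≈0 = begin
          x                     ≡⟨ +-identityʳ x ⟨
          x + 0                 ≈⟨ +-cong {x} refl d≈0 ⟨
          x + (y ∸ x)           ≡⟨ m+[n∸m]≡n x≤y ⟩
          y                     ∎

    *-cancelˡ : ∀ {c x y} → ¬ c ≈ 0 → c * x ≈ c * y → x ≈ y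
    *-cancelˡ c≉0 cx≈cy with ≤-total _ _
    ... | inj₁ x≤y = *-cancelˡ-ordered c≉0 x≤y cx≈cy
    ... | inj₂ y≤x = sym (*-cancelˡ-ordered c≉0 y≤x (sym cx≈cy))

T-not-∨⁺ : ∀ {a b} → (T a → T b) → T (not a ∨ b)
T-not-∨⁺ {false} a⇒b = _
T-not-∨⁺ {true}  a⇒b = a⇒b _

T-not-∨⁻ : ∀ {a b} → T (not a ∨ b) → T a → T b
T-not-∨⁻ {true} b _ = b

all-allFin⁺ : ∀ {n} {f : Fin n → Bool} → (∀ i → T (f i)) → T (all f (allFin n))
all-allFin⁺ {f = f} Tf = All.all⁻ f (All.tabulate⁺ Tf)

all-allFin⁻ : ∀ {n} {f : Fin n → Bool} → T (all f (allFin n)) → ∀ i → T (f i)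
all-allFin⁻ {f = f} T-all = All.tabulate⁻ (All.all⁺ f _ T-all)

module Linear (p : ℕ) .{{_ : NonZero p}} where

  open Congruence p

  allVectors : ∀ N → List (Fin N → Fin p)
  allVectors N = allFuns (allFin p) N

  allVectors-complete : ∀ {N} (v : Fin N → Fin p) → ∃[ g ] g ∈ allVectors N × g ≗ v
  allVectors-complete v = allFuns-complete (allFin p) v (λ _ → ∈-allFin _)

  length-allVectors : ∀ N → length (allVectors N) ≡ p ^ N
  length-allVectors N = trans (length-allFuns (allFin p) N) (cong (_^ N) (length-tabulate (λ i → i)))

  -- Vectors over F_p are represented by ℕ-valued coordinates compared with _≈_, while
  -- coefficients of linear combinations are elements of Fin p.
  combination : ∀ {N d} → (Fin N → Fin p) → (Fin N → Fin d → ℕ) → Fin d → ℕ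
  combination c v = (toℕ ∘ c) · v

  IsRelation : ∀ {N d} → (Fin N → Fin p) → (Fin N → Fin d → ℕ) → Set
  IsRelation c v = ∀ j → combination c v j ≈ 0

  Independent : ∀ {N d} → (Fin N → Fin d → ℕ) → Set
  Independent v = ∀ c → IsRelation c v → ∀ i → toℕ (c i) ≡ 0

  combination-congˡ : ∀ {N d} {c c' : Fin N → Fin p} (v : Fin N → Fin d → ℕ) → c ≗ c' →
                      ∀ j → combination c v j ≡ combination c' v j
  combination-congˡ {N} v c≗c' j = sumFin-cong N (λ i → cong (λ x → toℕ x * v i j) (c≗c' i))

  combination-congʳ : ∀ {N d} (c : Fin N → Fin p) {v w : Fin N → Fin d → ℕ} →
                      (∀ i j → v i j ≈ w i j) → ∀ j → combination c v j ≈ combination c w j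
  combination-congʳ {N} c v≈w j = sumFin-≈ N (λ i → *-cong {toℕ (c i)} refl (v≈w i j))

  Independent-resp : ∀ {N d} {v w : Fin N → Fin d → ℕ} → (∀ i j → v i j ≈ w i j) →
                     Independent v → Independent w
  Independent-resp v≈w v-ind c c-rel = v-ind c (λ j → trans (combination-congʳ c v≈w j) (c-rel j))

  ⟦_⟧ : ∀ {a b} → Mat p a b → Fin a → Fin b → ℕ
  ⟦ M ⟧ i j = toℕ (M i j)

  ⟦⊗⟧-≈ : ∀ {r m n} (Q : Mat p r m) (A : Mat p m n) i j →
          ⟦ p ⊗[ Q ] A ⟧ i j ≈ combination (Q i) ⟦ A ⟧ j
  ⟦⊗⟧-≈ Q A i j = toℕ-mod-≈ _

  private
    isZero-mod⁺ : ∀ {x} → x ≈ 0 → T (isZero (x mod p))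
    isZero-mod⁺ {x} x≈0 = ≡⇒≡ᵇ _ 0 (toℕ-≈0 (x mod p) (trans (toℕ-mod-≈ x) x≈0))

    isZero-mod⁻ : ∀ {x} → T (isZero (x mod p)) → x ≈ 0
    isZero-mod⁻ {x} T-isZero = trans (sym (toℕ-mod-≈ x)) (cong (_% p) (≡ᵇ⇒≡ _ 0 T-isZero))

    isZero⁻ : {x : Fin p} → T (isZero x) → toℕ x ≡ 0
    isZero⁻ = ≡ᵇ⇒≡ _ 0

    isZero⁺ : {x : Fin p} → toℕ x ≡ 0 → T (isZero x)
    isZero⁺ = ≡⇒≡ᵇ _ 0

  rowsIndependent⇒Independent : ∀ {a b N} (M : Mat p a b) (σ : Fin N → Fin a) →
                                T (rowsIndependent p M N σ) → Independent (⟦ M ⟧ ∘ σ)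
  rowsIndependent⇒Independent {N = N} M σ T-ind c c-rel i
    with g , g∈ , g≗c ← allVectors-complete c =
    trans (cong toℕ (sym (g≗c i))) (isZero⁻ (All.tabulate⁻ (All.map⁻ (All.all⁺ isZero _ g-zero)) i))
    where
    g-rel : ∀ j → combination g (⟦ M ⟧ ∘ σ) j ≈ 0
    g-rel j = trans (cong (_% p) (combination-congˡ (⟦ M ⟧ ∘ σ) g≗c j)) (c-rel j)
    g-zero : T (all isZero (map g (allFin N)))
    g-zero = T-not-∨⁻ (All.lookup (All.all⁺ _ _ T-ind) g∈) (all-allFin⁺ (isZero-mod⁺ ∘ g-rel))

  Independent⇒rowsIndependent : ∀ {a b N} (M : Mat p a b) (σ : Fin N → Fin a) →
                                Independent (⟦ M ⟧ ∘ σ) → T (rowsIndependent p M N σ)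
  Independent⇒rowsIndependent {b = b} {N} M σ ind =
    All.all⁻ check (All.universal check-holds (allVectors N))
    where
    check : (Fin N → Fin p) → Bool
    check c = not (all (λ j → isZero (combination c (⟦ M ⟧ ∘ σ) j mod p)) (allFin b))
              ∨ all isZero (map c (allFin N))
    check-holds : ∀ c → T (check c)
    check-holds c = T-not-∨⁺ λ T-rel → All.all⁻ isZero (All.map⁺ (All.tabulate⁺ {f = λ i → i}
      (isZero⁺ ∘ ind c (isZero-mod⁻ ∘ all-allFin⁻ T-rel))))

  rankAtLeast⇒Independent : ∀ {a b} (M : Mat p a b) N → rankAtLeast p M N ≡ true →
                            ∃[ σ ] Independent (⟦ M ⟧ ∘ σ)
  rankAtLeast⇒Independent {a} M N rank
    with σ , T-ind ← Any.satisfied (Any.any⁻ (rowsIndependent p M N) (allFuns (allFin a) N)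
                                      (Equivalence.from T-≡ rank))
    = σ , rowsIndependent⇒Independent M σ T-ind

  Independent⇒rankAtLeast : ∀ {a b N} (M : Mat p a b) (σ : Fin N → Fin a) →
                            Independent (⟦ M ⟧ ∘ σ) → rankAtLeast p M N ≡ true
  Independent⇒rankAtLeast {a} {N = N} M σ ind
    with τ , τ∈ , τ≗σ ← allFuns-complete (allFin a) σ (λ _ → ∈-allFin _)
    = Equivalence.to T-≡ (Any.any⁺ (rowsIndependent p M N) (lose τ∈
        (Independent⇒rowsIndependent M τ (Independent-resp τ-rows ind))))
    where
    τ-rows : ∀ i j → toℕ (M (σ i) j) ≈ toℕ (M (τ i) j)
    τ-rows i j = cong (λ x → toℕ (M x j) % p) (sym (τ≗σ i))

  combination-injective : ∀ {N d} {v : Fin N → Fin d → ℕ} → Independent v →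
                          ∀ {y y'} → (∀ j → combination y v j ≈ combination y' v j) → y ≗ y'
  combination-injective {N} {v = v} ind {y} {y'} y≈y' i =
    toℕ-≈-injective (+-cancelʳ (pred p * toℕ (y' i)) (trans c-zero (sym (+-negate (toℕ (y' i))))))
    where
    -- c = y - y', with -y' represented by pred p * y'.
    c : Fin N → Fin p
    c i = (toℕ (y i) + pred p * toℕ (y' i)) mod p
    split : ∀ j → sumFin N (λ i → (toℕ (y i) + pred p * toℕ (y' i)) * v i j)
                  ≡ combination y v j + pred p * combination y' v j
    split j = let open ≡-Reasoning in begin
      sumFin N (λ i → (toℕ (y i) + pred p * toℕ (y' i)) * v i j)
        ≡⟨ sumFin-cong N (λ i → trans (*-distribʳ-+ (v i j) (toℕ (y i)) _)
                                      (cong (toℕ (y i) * v i j +_) (*-assoc (pred p) (toℕ (y' i)) (v i j)))) ⟩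
      sumFin N (λ i → toℕ (y i) * v i j + pred p * (toℕ (y' i) * v i j))
        ≡⟨ sumFin-+ N _ _ ⟩
      combination y v j + sumFin N (λ i → pred p * (toℕ (y' i) * v i j))
        ≡⟨ cong (_ +_) (*-distribˡ-sumFin N (pred p) _) ⟨
      combination y v j + pred p * combination y' v j ∎
    c-rel : IsRelation c v
    c-rel j = let open ≈-Reasoning in begin
      combination c v j
        ≈⟨ sumFin-≈ N (λ i → *-cong (toℕ-mod-≈ _) refl) ⟩
      sumFin N (λ i → (toℕ (y i) + pred p * toℕ (y' i)) * v i j)
        ≡⟨ split j ⟩
      combination y v j + pred p * combination y' v j
        ≈⟨ +-cong (y≈y' j) refl ⟩
      combination y' v j + pred p * combination y' v j
        ≈⟨ +-negate _ ⟩
      0 ∎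
    c-zero : toℕ (y i) + pred p * toℕ (y' i) ≈ 0
    c-zero = trans (sym (toℕ-mod-≈ _)) (cong (_% p) (ind c c-rel i))

module Pivots (p : ℕ) .{{_ : NonZero p}} {m n : ℕ} (A : Mat p m n) where

  open Congruence p
  open Linear p

  Row : Set
  Row = Fin m → Fin p

  image : Row → Fin n → ℕ
  image x = combination x ⟦ A ⟧

  images : (S : List Row) → Fin (length S) → Fin n → ℕ
  images S i = image (lookup S i)

  -- xA lies in the span of the images of S.
  Dependent : List Row → Row → Set
  Dependent S x = ∃[ c ] toℕ (c fz) ≢ 0 × IsRelation c (images (x ∷ S))

  Dependent? : ∀ S x → Dec (Dependent S x)
  Dependent? S x = ∃-allFuns? (allFin p) ∈-allFin resp
    (λ c → ¬? (toℕ (c fz) ≟ 0) ×-dec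
           Fin.all? (λ j → combination c (images (x ∷ S)) j % p ≟ 0 % p))
    where
    resp : ∀ {c c'} → c ≗ c' → toℕ (c fz) ≢ 0 × IsRelation c (images (x ∷ S)) →
           toℕ (c' fz) ≢ 0 × IsRelation c' (images (x ∷ S))
    resp c≗c' (c₀≢0 , c-rel) =
      (λ c'₀≡0 → c₀≢0 (trans (cong toℕ (c≗c' fz)) c'₀≡0)) ,
      (λ j → trans (cong (_% p) (sym (combination-congˡ (images (x ∷ S)) c≗c' j))) (c-rel j))

  data Echelon : List Row → Set where
    []  : Echelon []
    _∷_ : ∀ {x S} → ¬ Dependent S x → Echelon S → Echelon (x ∷ S)

  Echelon⇒Independent : ∀ {S} → Echelon S → Independent (images S)
  Echelon⇒Independent {x ∷ S} (x-free ∷ ech) c c-rel i with toℕ (c fz) ≟ 0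
  ... | no  c₀≢0 = contradiction (c , c₀≢0 , c-rel) x-free
  ... | yes c₀≡0 with i
  ...   | fz   = c₀≡0
  ...   | fs i = Echelon⇒Independent ech (c ∘ fs) tail-rel i
    where
    tail-rel : IsRelation (c ∘ fs) (images S)
    tail-rel j =
      trans (cong (λ c₀ → (c₀ * image x j + combination (c ∘ fs) (images S) j) % p) (sym c₀≡0)) (c-rel j)

  pivots : List Row → ∀ s → (Fin s → Row) → ℕ
  pivots S zero    Q = 0
  pivots S (suc s) Q =
    if does (Dependent? S (Q fz)) then pivots S s (Q ∘ fs) else suc (pivots (Q fz ∷ S) s (Q ∘ fs))

  RowOf : ∀ {s} → (Fin s → Row) → Row → Set
  RowOf Q x = ∃[ i ] Q i ≡ x

  -- Rows kept later come first, so a row kept now goes to the end of L.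
  echelon-of-pivots : ∀ {S} s (Q : Fin s → Row) t → Echelon S → t ≤ pivots S s Q →
                      ∃[ L ] length L ≡ t × All (RowOf Q) L × Echelon (L ++ S)
  echelon-of-pivots zero Q zero ech t≤ = [] , refl , [] , ech
  echelon-of-pivots {S} (suc s) Q t ech t≤ with Dependent? S (Q fz)
  ... | yes _ with L , |L| , L⊆Q , ech′ ← echelon-of-pivots s (Q ∘ fs) t ech t≤ =
    L , |L| , All.map (λ (i , eq) → fs i , eq) L⊆Q , ech′
  echelon-of-pivots {S} (suc s) Q zero ech t≤ | no _ = [] , refl , [] , ech
  echelon-of-pivots {S} (suc s) Q (suc t) ech t≤ | no x-free
    with L , |L| , L⊆Q , ech′ ← echelon-of-pivots s (Q ∘ fs) t (x-free ∷ ech) (s≤s⁻¹ t≤) =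
    L ++ [ Q fz ] ,
    trans (length-++ L) (trans (cong (_+ 1) |L|) (+-comm t 1)) ,
    All.++⁺ (All.map (λ (i , eq) → fs i , eq) L⊆Q) ((fz , refl) ∷ []) ,
    subst Echelon (sym (++-assoc L [ Q fz ] S)) ech′

  rank-of-pivots : ∀ {r} (Q : Mat p r m) t → t ≤ pivots [] r Q →
                   rankAtLeast p (p ⊗[ Q ] A) t ≡ true
  rank-of-pivots {r} Q t t≤ with L , |L| , L⊆Q , ech ← echelon-of-pivots r Q t [] t≤ =
    subst (λ t → rankAtLeast p (p ⊗[ Q ] A) t ≡ true) |L|
      (Independent⇒rankAtLeast (p ⊗[ Q ] A) σ
        (Independent-resp rows-of-QA (Echelon⇒Independent (subst Echelon (++-identityʳ L) ech))))
    where
    σ : Fin (length L) → Fin r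
    σ a = proj₁ (All.lookup L⊆Q (∈-lookup a))
    Qσ≡ : ∀ a → Q (σ a) ≡ lookup L a
    Qσ≡ a = proj₂ (All.lookup L⊆Q (∈-lookup a))
    rows-of-QA : ∀ a j → images L a j ≈ ⟦ p ⊗[ Q ] A ⟧ (σ a) j
    rows-of-QA a j = trans (cong (λ x → image x j % p) (sym (Qσ≡ a))) (sym (⟦⊗⟧-≈ Q A (σ a) j))

-- An upper bound for Σ_{j<t} C(s, j), the number of positions of fewer than t kept rows among s
-- revealed rows, which still satisfies Pascal's rule up to ≤ (patternBound-step).
patternBound : ℕ → ℕ → ℕ
patternBound s zero          = 0
patternBound s (suc zero)    = 1
patternBound s (suc (suc _)) = 2 ^ s

patternBound-step : ∀ s t → patternBound s t + patternBound s (suc t) ≤ patternBound (suc s) (suc t)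
patternBound-step s zero          = ≤-refl
patternBound-step s (suc zero)    =
  ≤-trans (≤-reflexive (+-comm 1 (2 ^ s)))
          (+-monoʳ-≤ (2 ^ s) (≤-trans (m^n>0 2 s) (m≤m+n (2 ^ s) 0)))
patternBound-step s (suc (suc t)) = ≤-reflexive (cong (2 ^ s +_) (sym (+-identityʳ (2 ^ s))))

1≤patternBound : ∀ s t → 1 ≤ patternBound s (suc t)
1≤patternBound s zero    = ≤-refl
1≤patternBound s (suc t) = m^n>0 2 s

^-distribʳ-* : ∀ x y n → (x * y) ^ n ≡ x ^ n * y ^ n
^-distribʳ-* x y zero    = refl
^-distribʳ-* x y (suc n) = trans (cong (x * y *_) (^-distribʳ-* x y n)) (interchange x y (x ^ n) (y ^ n))
  where
  interchange : ∀ a b c d → a * b * (c * d) ≡ a * c * (b * d)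
  interchange = solve-∀

^-cancelʳ-≤ : ∀ n .{{_ : NonZero n}} {x y} → x ^ n ≤ y ^ n → x ≤ y
^-cancelʳ-≤ n {x} {y} xⁿ≤yⁿ with x ≤? y
... | yes x≤y = x≤y
... | no  x≰y = contradiction xⁿ≤yⁿ (<⇒≱ (^-monoˡ-< n (≰⇒> x≰y)))

2^-cancel-≤ : ∀ {x y} → 2 ^ x ≤ 2 ^ y → x ≤ y
2^-cancel-≤ {x} {y} 2ˣ≤2ʸ with x ≤? y
... | yes x≤y = x≤y
... | no  x≰y = contradiction 2ˣ≤2ʸ (<⇒≱ (^-monoʳ-< 2 (s≤s (s≤s z≤n)) (≰⇒> x≰y)))

good-count-bound : ∀ {T G F a b} → T ≤ F + G → F * b ≤ a * T → (b ∸ a) * T ≤ G * b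
good-count-bound {T} {G} {F} {a} {b} T≤F+G Fb≤aT = begin
  (b ∸ a) * T       ≡⟨ *-distribʳ-∸ T b a ⟩
  b * T ∸ a * T     ≤⟨ ∸-monoʳ-≤ (b * T) Fb≤aT ⟩
  b * T ∸ F * b     ≡⟨ cong (_∸ F * b) (*-comm b T) ⟩
  T * b ∸ F * b     ≡⟨ *-distribʳ-∸ b T F ⟨
  (T ∸ F) * b       ≤⟨ *-monoˡ-≤ b (m≤n+o⇒m∸n≤o T F T≤F+G) ⟩
  G * b             ∎
  where open ≤-Reasoning

root-comparison : ∀ N .{{_ : NonZero N}} {F T W R Y a b : ℕ} .{{_ : NonZero Y}} →
                  F * Y ≤ W * T → b ^ N ≤ 2 ^ R * a ^ N → W ^ N * 2 ^ R ≤ Y ^ N → F * b ≤ a * T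
root-comparison N {F} {T} {W} {R} {Y} {a} {b} FY≤WT bᴺ≤ Wᴺ2ᴿ≤Yᴺ =
  ^-cancelʳ-≤ N (*-cancelʳ-≤ ((F * b) ^ N) ((a * T) ^ N) (Y ^ N) {{m^n≢0 Y N}} (begin
    (F * b) ^ N * Y ^ N              ≡⟨ regroup₁ ⟩
    (F * Y) ^ N * b ^ N              ≤⟨ *-mono-≤ (^-monoˡ-≤ N FY≤WT) bᴺ≤ ⟩
    (W * T) ^ N * (2 ^ R * a ^ N)    ≡⟨ regroup₂ ⟩
    W ^ N * 2 ^ R * (a * T) ^ N      ≤⟨ *-monoˡ-≤ ((a * T) ^ N) Wᴺ2ᴿ≤Yᴺ ⟩
    Y ^ N * (a * T) ^ N              ≡⟨ *-comm (Y ^ N) _ ⟩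
    (a * T) ^ N * Y ^ N              ∎))
  where
  open ≤-Reasoning
  regroup₁ : (F * b) ^ N * Y ^ N ≡ (F * Y) ^ N * b ^ N
  regroup₁ = trans (cong (_* Y ^ N) (^-distribʳ-* F b N))
             (trans (swap (F ^ N) (b ^ N) (Y ^ N)) (cong (_* b ^ N) (sym (^-distribʳ-* F Y N))))
    where
    swap : ∀ x y z → x * y * z ≡ x * z * y
    swap = solve-∀
  regroup₂ : (W * T) ^ N * (2 ^ R * a ^ N) ≡ W ^ N * 2 ^ R * (a * T) ^ N
  regroup₂ = trans (cong (_* (2 ^ R * a ^ N)) (^-distribʳ-* W T N))
             (trans (shuffle (W ^ N) (T ^ N) (2 ^ R) (a ^ N))
                    (cong (W ^ N * 2 ^ R *_) (sym (^-distribʳ-* a T N))))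
    where
    shuffle : ∀ w t r x → w * t * (r * x) ≡ w * r * (x * t)
    shuffle = solve-∀

7r≤8[r∸n] : ∀ {r n} → 8 * n ≤ r → 7 * r ≤ 8 * (r ∸ n)
7r≤8[r∸n] {r} {n} 8n≤r = begin
  7 * r              ≡⟨ m+n∸n≡m (7 * r) r ⟨
  7 * r + r ∸ r      ≡⟨ cong (_∸ r) (+-comm (7 * r) r) ⟩
  8 * r ∸ r          ≤⟨ ∸-monoʳ-≤ (8 * r) 8n≤r ⟩
  8 * r ∸ 8 * n      ≡⟨ *-distribˡ-∸ 8 r n ⟨
  8 * (r ∸ n)        ∎
  where open ≤-Reasoning

exponent-bound : ∀ {r k k'} → 2 ≤ k' → 2 * k' ≤ k → 8 * k' ≤ r →
                 r * (8 * k') + r * k ≤ (k ∸ k') * (suc r ∸ k') * (8 * k')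
exponent-bound {r} {k} {k'} 2≤k' 2k'≤k 8k'≤r = begin
  r * N + r * k                  ≡⟨ *-distribˡ-+ r N k ⟨
  r * (8 * k' + k)               ≤⟨ *-monoʳ-≤ r (+-mono-≤ (*-monoʳ-≤ 8 k'≤e) k≤2e) ⟩
  r * (8 * e + 2 * e)            ≡⟨ shuffle₁ r e ⟩
  10 * (e * r)                   ≤⟨ *-monoˡ-≤ (e * r) (m≤m+n 10 4) ⟩
  14 * (e * r)                   ≡⟨ shuffle₂ e r ⟩
  e * (7 * r) * 2                ≤⟨ *-mono-≤ (*-monoʳ-≤ e (7r≤8[r∸n] {n = k'} 8k'≤r)) 2≤k' ⟩
  e * (8 * (r ∸ k')) * k'        ≡⟨ shuffle₃ e (r ∸ k') k' ⟩
  e * (r ∸ k') * N               ≤⟨ *-monoˡ-≤ N (*-monoʳ-≤ e (∸-monoˡ-≤ k' (n≤1+n r))) ⟩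
  e * (suc r ∸ k') * N           ∎
  where
  open ≤-Reasoning
  N = 8 * k'
  e = k ∸ k'
  k'≤e : k' ≤ e
  k'≤e = m+n≤o⇒m≤o∸n k' (≤-trans (≤-reflexive (cong (k' +_) (sym (+-identityʳ k')))) 2k'≤k)
  k≤2e : k ≤ 2 * e
  k≤2e = ≤-trans (≤-reflexive (sym (m∸n+n≡m (≤-trans (m≤m+n k' (k' + 0)) 2k'≤k))))
                 (≤-trans (+-monoʳ-≤ e k'≤e) (≤-reflexive (cong (e +_) (sym (+-identityʳ e)))))
  shuffle₁ : ∀ r e → r * (8 * e + 2 * e) ≡ 10 * (e * r)
  shuffle₁ = solve-∀
  shuffle₂ : ∀ e r → 14 * (e * r) ≡ e * (7 * r) * 2
  shuffle₂ = solve-∀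
  shuffle₃ : ∀ e d k' → e * (8 * d) * k' ≡ e * d * (8 * k')
  shuffle₃ = solve-∀

pattern-exponent : ∀ {r k k'} → 1 ≤ k' → 2 * k' ≤ k → 8 * k' ≤ r →
  patternBound r k' ^ (8 * k') * 2 ^ (r * k) ≤ 2 ^ ((k ∸ k') * (suc r ∸ k') * (8 * k'))
pattern-exponent {k = zero}        {suc zero} _ () _
pattern-exponent {k = suc zero}    {suc zero} _ (s≤s ()) _
pattern-exponent {r} {suc (suc j)} {suc zero} _ _ _ = begin
  1 * 2 ^ (r * suc (suc j))      ≡⟨ *-identityˡ _ ⟩
  2 ^ (r * suc (suc j))          ≤⟨ ^-monoʳ-≤ 2 (*-monoʳ-≤ r 2+j≤8+8j) ⟩
  2 ^ (r * (8 + 8 * j))          ≡⟨ cong (2 ^_) (reorder r j) ⟩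
  2 ^ (suc j * r * 8)            ∎
  where
  open ≤-Reasoning
  2+j≤8+8j : 2 + j ≤ 8 + 8 * j
  2+j≤8+8j = +-mono-≤ {2} {8} (s≤s (s≤s z≤n)) (m≤n*m j 8)
  reorder : ∀ r j → r * (8 + 8 * j) ≡ (1 + j) * r * 8
  reorder = solve-∀
pattern-exponent {r} {k} {k'@(suc (suc _))} _ 2k'≤k 8k'≤r = begin
  (2 ^ r) ^ N * 2 ^ (r * k)            ≡⟨ cong (_* 2 ^ (r * k)) (^-*-assoc 2 r N) ⟩
  2 ^ (r * N) * 2 ^ (r * k)            ≡⟨ ^-distribˡ-+-* 2 (r * N) (r * k) ⟨
  2 ^ (r * N + r * k)                  ≤⟨ ^-monoʳ-≤ 2 (exponent-bound (s≤s (s≤s z≤n)) 2k'≤k 8k'≤r) ⟩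
  2 ^ ((k ∸ k') * (suc r ∸ k') * N)    ∎
  where
  open ≤-Reasoning
  N = 8 * k'

power-gap : ∀ {a b k N r} .{{_ : NonZero a}} .{{_ : NonZero k}} →
            2 ^ k * a ≤ b → b ^ N ≤ 2 ^ (r * k) * a ^ N → N ≤ r
power-gap {a} {b} {k} {N} {r} 2ᵏa≤b bᴺ≤ =
  *-cancelˡ-≤ k (≤-trans (2^-cancel-≤ 2ᵏᴺ≤2ʳᵏ) (≤-reflexive (*-comm r k)))
  where
  open ≤-Reasoning
  2ᵏᴺ≤2ʳᵏ : 2 ^ (k * N) ≤ 2 ^ (r * k)
  2ᵏᴺ≤2ʳᵏ = *-cancelʳ-≤ (2 ^ (k * N)) (2 ^ (r * k)) (a ^ N) {{m^n≢0 a N}} (begin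
    2 ^ (k * N) * a ^ N      ≡⟨ cong (_* a ^ N) (^-*-assoc 2 k N) ⟨
    (2 ^ k) ^ N * a ^ N      ≡⟨ ^-distribʳ-* (2 ^ k) a N ⟨
    (2 ^ k * a) ^ N          ≤⟨ ^-monoˡ-≤ N 2ᵏa≤b ⟩
    b ^ N                    ≤⟨ bᴺ≤ ⟩
    2 ^ (r * k) * a ^ N      ∎)

^-suc-∸-≤ : ∀ p .{{_ : NonZero p}} e s t → p ^ (e * (suc s ∸ t)) ≤ p ^ e * p ^ (e * (s ∸ t))
^-suc-∸-≤ p e s t =
  ≤-trans (^-monoʳ-≤ p (*-monoʳ-≤ e (suc-∸ s t)))
          (≤-reflexive (trans (cong (p ^_) (*-suc e (s ∸ t))) (^-distribˡ-+-* p e _)))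
  where
  suc-∸ : ∀ a b → suc a ∸ b ≤ suc (a ∸ b)
  suc-∸ a       zero    = ≤-refl
  suc-∸ zero    (suc b) = ≤-trans (≤-reflexive (0∸n≡0 b)) z≤n
  suc-∸ (suc a) (suc b) = suc-∸ a b

module Counting (p : ℕ) .{{_ : NonZero p}} (prime-p : Prime p) {m n : ℕ} (A : Mat p m n)
                {k : ℕ} (τ : Fin k → Fin m)
                (τ-independent : Linear.Independent p (Linear.⟦_⟧ p A ∘ τ)) where

  open Congruence p
  open Linear p
  open Pivots p A

  allRows : List Row
  allRows = allVectors m

  ε : Fin k → Fin m → ℕ
  ε i = unit (τ i)

  shifted : (S : List Row) → Row → (Fin k → Fin p) → (Fin (suc (length S)) → Fin p) → Fin m → ℕ
  shifted S x y c l = combination c ⟦ lookup (x ∷ S) ⟧ l + combination y ε l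

  image-shifted : ∀ S x y c j →
    (shifted S x y c · ⟦ A ⟧) j ≡ combination c (images (x ∷ S)) j + combination y (⟦ A ⟧ ∘ τ) j
  image-shifted S x y c j =
    trans (·-distribʳ-+ (combination c ⟦ lookup (x ∷ S) ⟧) (combination y ε) ⟦ A ⟧ j)
      (cong₂ _+_ (·-assoc (toℕ ∘ c) ⟦ lookup (x ∷ S) ⟧ ⟦ A ⟧ j)
                 (trans (·-assoc (toℕ ∘ y) ε ⟦ A ⟧ j)
                        (sumFin-cong k (λ i → cong (toℕ (y i) *_) (sumFin-unit m (τ i) (λ l → toℕ (A l j)))))))

  Code : List Row → Set
  Code S = (Fin (suc (length S)) → Fin p) × Row

  -- Decoding: the image of the shifted vector under A is Σ yᵢ A_{τ i}, which determines y since
  -- the rows τ of A are independent; then x is recovered because c₀ is invertible mod p.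
  Encodes : (S : List Row) → Row × (Fin k → Fin p) → Code S → Set
  Encodes S (x , y) (c , w) =
    toℕ (c fz) ≢ 0 × IsRelation c (images (x ∷ S)) × (∀ l → toℕ (w l) ≈ shifted S x y c l)

  Encodes-injective : ∀ S {u u' code} → Encodes S u code → Encodes S u' code →
                      proj₁ u ≗ proj₁ u' × proj₂ u ≗ proj₂ u'
  Encodes-injective S {x , y} {x' , y'} {c , w} (c₀≢0 , rel , w≈) (_ , rel' , w≈') = x≗x' , y≗y'
    where
    same-shift : ∀ l → shifted S x y c l ≈ shifted S x' y' c l
    same-shift l = trans (sym (w≈ l)) (w≈' l)
    y≗y' : y ≗ y'
    y≗y' = combination-injective τ-independent λ j → let open ≈-Reasoning in begin
      combination y (⟦ A ⟧ ∘ τ) j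
        ≈⟨ +-cong (rel j) refl ⟨
      combination c (images (x ∷ S)) j + combination y (⟦ A ⟧ ∘ τ) j
        ≡⟨ image-shifted S x y c j ⟨
      (shifted S x y c · ⟦ A ⟧) j
        ≈⟨ sumFin-≈ m (λ l → *-cong (same-shift l) refl) ⟩
      (shifted S x' y' c · ⟦ A ⟧) j
        ≡⟨ image-shifted S x' y' c j ⟩
      combination c (images (x' ∷ S)) j + combination y' (⟦ A ⟧ ∘ τ) j
        ≈⟨ +-cong (rel' j) refl ⟩
      combination y' (⟦ A ⟧ ∘ τ) j ∎
    c₀≉0 : ¬ toℕ (c fz) ≈ 0
    c₀≉0 = c₀≢0 ∘ toℕ-≈0 (c fz)
    x≗x' : x ≗ x'
    x≗x' l = toℕ-≈-injective
      (*-cancelˡ prime-p c₀≉0 (+-cancelʳ (combination (c ∘ fs) ⟦ lookup S ⟧ l)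
                                          (+-cancelʳ (combination y ε l) same-tail)))
      where
      same-tail : shifted S x y c l ≈ combination c ⟦ lookup (x' ∷ S) ⟧ l + combination y ε l
      same-tail = trans (same-shift l) (cong (λ e → (combination c ⟦ lookup (x' ∷ S) ⟧ l + e) % p)
                                             (combination-congˡ ε (sym ∘ y≗y') l))

  dependentCount : List Row → ℕ
  dependentCount S = length (filter (Dependent? S) allRows)

  dependentCount-by-coding : ∀ S → dependentCount S * p ^ k ≤ p ^ suc (length S) * p ^ m
  dependentCount-by-coding S = subst₂ _≤_
    (trans (length-cartesianProduct dependents _) (cong (length dependents *_) (length-allVectors k)))
    (trans (length-cartesianProduct (allVectors (suc (length S))) allRows)
           (cong₂ _*_ (length-allVectors (suc (length S))) (length-allVectors m)))
    (length-≤-by-coding RowPairs (Encodes S) (λ {u} {u'} {code} → Encodes-injective S {u} {u'} {code})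
       (cartesianProduct (allVectors (suc (length S))) allRows)
       (Unique.cartesianProduct⁺ Rows Coeffs
          (Unique.filter⁺ Rows (Dependent? S) (allFuns-unique (allFin⁺ p) m))
          (allFuns-unique (allFin⁺ p) k))
       code)
    where
    Rows = Fin m →-setoid Fin p
    Coeffs = Fin k →-setoid Fin p
    RowPairs = ×-setoid Rows Coeffs
    dependents = filter (Dependent? S) allRows
    code : ∀ {u} → u ∈ cartesianProduct dependents (allVectors k) →
           ∃[ c ] c ∈ cartesianProduct (allVectors (suc (length S))) allRows × Encodes S u c
    code {x , y} u∈ with x∈ , _ ← ∈-cartesianProduct⁻ dependents _ u∈
      with c₀ , c₀≢0 , rel ← proj₂ (∈-filter⁻ (Dependent? S) {xs = allRows} x∈)
      with c , c∈ , c≗c₀ ← allVectors-complete c₀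
      with w , w∈ , w≗ ← allVectors-complete (λ l → shifted S x y c l mod p) =
      (c , w) , ∈-cartesianProduct⁺ c∈ w∈ ,
      (λ c₀≡0 → c₀≢0 (trans (cong toℕ (sym (c≗c₀ fz))) c₀≡0)) ,
      (λ j → trans (cong (_% p) (combination-congˡ (images (x ∷ S)) c≗c₀ j)) (rel j)) ,
      (λ l → trans (cong (λ z → toℕ z % p) (w≗ l)) (toℕ-mod-≈ _))

  badCount : List Row → ℕ → ℕ → ℕ
  badCount S s t = length (filter (λ Q → pivots S s Q <? t) (allFuns allRows s))

  badCount-split : ∀ S s t → badCount S (suc s) (suc t) ≡
    sum (map (λ x → if does (Dependent? S x) then badCount S s (suc t) else badCount (x ∷ S) s t)
             allRows)
  badCount-split S s t =
    trans (length-filter-concatMap _ _ allRows) (cong sum (map-cong split allRows))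
    where
    split : ∀ x → _ ≡ (if does (Dependent? S x) then badCount S s (suc t) else badCount (x ∷ S) s t)
    split x = trans (length-filter-map _ _ (allFuns allRows s)) (by-cases (does (Dependent? S x)))
      where
      by-cases : ∀ b →
        length (filter (λ Q → (if b then pivots S s Q else suc (pivots (x ∷ S) s Q)) <? suc t)
                       (allFuns allRows s))
        ≡ (if b then badCount S s (suc t) else badCount (x ∷ S) s t)
      by-cases true  = refl
      by-cases false = cong length (filter-≐ _ _ (s≤s⁻¹ , s≤s) (allFuns allRows s))

  matrices≤badCount+goodCount : ∀ r k' → (p ^ m) ^ r ≤ badCount [] r k' + goodCount p r A k'
  matrices≤badCount+goodCount r k' = begin
    (p ^ m) ^ r
      ≡⟨ trans (length-allFuns allRows r) (cong (_^ r) (length-allVectors m)) ⟨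
    length (allMats p r m)
      ≡⟨ length-filter+length-filter-¬ good? (allMats p r m) ⟨
    goodCount p r A k' + length (filter (¬? ∘ good?) (allMats p r m))
      ≤⟨ +-monoʳ-≤ (goodCount p r A k') bad≤badCount ⟩
    goodCount p r A k' + badCount [] r k'
      ≡⟨ +-comm (goodCount p r A k') _ ⟩
    badCount [] r k' + goodCount p r A k' ∎
    where
    open ≤-Reasoning
    good? : (Q : Mat p r m) → Dec (rankAtLeast p (p ⊗[ Q ] A) k' ≡ true)
    good? Q = rankAtLeast p (p ⊗[ Q ] A) k' Bool.≟ true
    bad≤badCount : length (filter (¬? ∘ good?) (allMats p r m)) ≤ badCount [] r k'
    bad≤badCount = length-filter-mono (¬? ∘ good?) (λ Q → pivots [] r Q <? k')
      (λ not-good → ≰⇒> (not-good ∘ rank-of-pivots _ k')) (allMats p r m)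

  module _ {k' : ℕ} (k'≤k : k' ≤ k) where

    private
      e P : ℕ
      e = k ∸ k'
      P = p ^ m

    dependentCount-bound : ∀ S → suc (length S) ≤ k' → dependentCount S * p ^ e ≤ P
    dependentCount-bound S |S|<k' =
      *-cancelʳ-≤ (dependentCount S * p ^ e) P (p ^ k') {{m^n≢0 p k'}} (begin
        dependentCount S * p ^ e * p ^ k'     ≡⟨ *-assoc (dependentCount S) (p ^ e) (p ^ k') ⟩
        dependentCount S * (p ^ e * p ^ k')   ≡⟨ cong (dependentCount S *_) pᵉpᵏ'≡pᵏ ⟩
        dependentCount S * p ^ k              ≤⟨ dependentCount-by-coding S ⟩
        p ^ suc (length S) * P                ≤⟨ *-monoˡ-≤ P (^-monoʳ-≤ p |S|<k') ⟩
        p ^ k' * P                            ≡⟨ *-comm (p ^ k') P ⟩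
        P * p ^ k'                            ∎)
      where
      open ≤-Reasoning
      pᵉpᵏ'≡pᵏ : p ^ e * p ^ k' ≡ p ^ k
      pᵉpᵏ'≡pᵏ = trans (sym (^-distribˡ-+-* p e k')) (cong (p ^_) (m∸n+n≡m k'≤k))

    BadCountBound : ℕ → List Row → ℕ → Set
    BadCountBound s S t = badCount S s t * p ^ (e * (suc s ∸ t)) ≤ patternBound s t * P ^ s

    badCount-extra-row : ∀ s S t → BadCountBound s S (suc t) →
                         badCount S s (suc t) * p ^ (e * (suc s ∸ t))
                           ≤ p ^ e * (patternBound s (suc t) * P ^ s)
    badCount-extra-row s S t bound = begin
      B * p ^ (e * (suc s ∸ t))        ≤⟨ *-monoʳ-≤ B (^-suc-∸-≤ p e s t) ⟩
      B * (p ^ e * p ^ (e * (s ∸ t)))  ≡⟨ rotate B (p ^ e) _ ⟩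
      p ^ e * (B * p ^ (e * (s ∸ t)))  ≤⟨ *-monoʳ-≤ (p ^ e) bound ⟩
      p ^ e * (patternBound s (suc t) * P ^ s) ∎
      where
      open ≤-Reasoning
      B : ℕ
      B = badCount S s (suc t)
      rotate : ∀ a b c → a * (b * c) ≡ b * (a * c)
      rotate = solve-∀

    badCount-step : ∀ s S t → length S + suc t ≤ k' →
                    (∀ S' t' → length S' + t' ≤ k' → BadCountBound s S' t') →
                    BadCountBound (suc s) S (suc t)
    badCount-step s S t |S|+t<k' bound = begin
      badCount S (suc s) (suc t) * w
        ≡⟨ cong (_* w) (badCount-split S s t) ⟩
      sum (map g allRows) * w
        ≤⟨ sum-*-≤ (Dependent? S) g dependent-case free-case allRows ⟩
      length allRows * B₁ + dependentCount S * (p ^ e * B₂)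
        ≤⟨ +-mono-≤ (≤-reflexive (cong (_* B₁) (length-allVectors m))) dependent-total ⟩
      P * B₁ + P * B₂
        ≡⟨ regroup P (patternBound s t) (patternBound s (suc t)) (P ^ s) ⟩
      (patternBound s t + patternBound s (suc t)) * (P * P ^ s)
        ≤⟨ *-monoˡ-≤ (P * P ^ s) (patternBound-step s t) ⟩
      patternBound (suc s) (suc t) * P ^ suc s ∎
      where
      open ≤-Reasoning
      |x∷S|+t≤k' : suc (length S) + t ≤ k'
      |x∷S|+t≤k' = ≤-trans (≤-reflexive (sym (+-suc (length S) t))) |S|+t<k'
      w B₁ B₂ : ℕ
      w = p ^ (e * (suc s ∸ t))
      g : Row → ℕ
      g x = if does (Dependent? S x) then badCount S s (suc t) else badCount (x ∷ S) s t
      B₁ = patternBound s t * P ^ s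
      B₂ = patternBound s (suc t) * P ^ s
      regroup : ∀ a b c d → a * (b * d) + a * (c * d) ≡ (b + c) * (a * d)
      regroup = solve-∀
      dependent-case : ∀ {x} → Dependent S x → g x * w ≤ p ^ e * B₂
      dependent-case {x} dep rewrite dec-true (Dependent? S x) dep =
        badCount-extra-row s S t (bound S (suc t) |S|+t<k')
      free-case : ∀ {x} → ¬ Dependent S x → g x * w ≤ B₁
      free-case {x} free rewrite dec-false (Dependent? S x) free =
        bound (x ∷ S) t |x∷S|+t≤k'
      dependent-total : dependentCount S * (p ^ e * B₂) ≤ P * B₂
      dependent-total = begin
        dependentCount S * (p ^ e * B₂)   ≡⟨ *-assoc (dependentCount S) (p ^ e) B₂ ⟨
        dependentCount S * p ^ e * B₂     ≤⟨ *-monoˡ-≤ B₂ (dependentCount-bound S |S|<k') ⟩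
        P * B₂                            ∎
        where
        |S|<k' : suc (length S) ≤ k'
        |S|<k' = ≤-trans (s≤s (m≤m+n (length S) t)) |x∷S|+t≤k'

    badCount-bound : ∀ s S t → length S + t ≤ k' → BadCountBound s S t
    badCount-bound s S zero _
      rewrite filter-none (λ Q → pivots S s Q <? 0) (All.universal (λ _ ()) (allFuns allRows s)) = z≤n
    badCount-bound zero S (suc t) _ = begin
      badCount S 0 (suc t) * p ^ (e * (1 ∸ suc t))
        ≡⟨ cong (λ d → badCount S 0 (suc t) * p ^ d) (trans (cong (e *_) (0∸n≡0 t)) (*-zeroʳ e)) ⟩
      badCount S 0 (suc t) * 1
        ≡⟨ *-identityʳ _ ⟩
      badCount S 0 (suc t)
        ≤⟨ length-filter (λ Q → pivots S 0 Q <? suc t) (allFuns allRows 0) ⟩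
      1
        ≤⟨ 1≤patternBound 0 t ⟩
      patternBound 0 (suc t)
        ≡⟨ *-identityʳ _ ⟨
      patternBound 0 (suc t) * 1 ∎
      where open ≤-Reasoning
    badCount-bound (suc s) S (suc t) |S|+t<k' = badCount-step s S t |S|+t<k' (badCount-bound s)

lemma3p1 : (p : ℕ) (pp : Prime p) (m n k : ℕ) → 1 ≤ m → 1 ≤ n → 1 ≤ k →
    (A : Mat p m n) → rankAtLeast p {{prime⇒nonZero pp}} A k ≡ true →
    (k' : ℕ) → 1 ≤ k' → 2 * k' ≤ k →
    (a b : ℕ) → 0 < a → a < b → 2 ^ k * a ≤ b →
    (r : ℕ) → b ^ (8 * k') ≤ 2 ^ (r * k) * a ^ (8 * k') →
    (∀ s → b ^ (8 * k') ≤ 2 ^ (s * k) * a ^ (8 * k') → r ≤ s) →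
    (b ∸ a) * p ^ (r * m) ≤ goodCount p {{prime⇒nonZero pp}} r A k' * b
lemma3p1 p pp m n k _ _ 1≤k A rank-A k' 1≤k' 2k'≤k a b 0<a _ 2ᵏa≤b r bᴺ≤ _
  with τ , τ-independent ← Linear.rankAtLeast⇒Independent p {{prime⇒nonZero pp}} A k rank-A =
  subst (λ T → (b ∸ a) * T ≤ goodCount p r A k' * b) (trans (^-*-assoc p m r) (cong (p ^_) (*-comm m r)))
    (good-count-bound {F = F} {a} (matrices≤badCount+goodCount r k')
      (root-comparison N {F} {R = r * k} {a = a} {{m^n≢0 p E}} (badCount-bound k'≤k r [] k' ≤-refl)
                       bᴺ≤ exponent))
  where
  instance
    p≢0 : NonZero p
    p≢0 = prime⇒nonZero pp
  N E : ℕ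
  N = 8 * k'
  E = (k ∸ k') * (suc r ∸ k')
  instance
    N≢0 : NonZero N
    N≢0 = >-nonZero (≤-trans (s≤s z≤n) (*-monoʳ-≤ 8 1≤k'))
  open Counting p pp A τ τ-independent
  F : ℕ
  F = badCount [] r k'
  k'≤k : k' ≤ k
  k'≤k = ≤-trans (m≤m+n k' (k' + 0)) 2k'≤k
  exponent : patternBound r k' ^ N * 2 ^ (r * k) ≤ (p ^ E) ^ N
  exponent = ≤-trans (pattern-exponent 1≤k' 2k'≤k (power-gap {{>-nonZero 0<a}} {{>-nonZero 1≤k}} 2ᵏa≤b bᴺ≤))
    (≤-trans (≤-reflexive (sym (^-*-assoc 2 E N)))
             (^-monoˡ-≤ N (^-monoˡ-≤ E (nonTrivial⇒n>1 p {{prime⇒nonTrivial pp}}))))
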